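{- Let $k\geq 3$, let $G$ be a $K_2\vee P_k$-saturated graph, let $u,v\in V(G)$ with $uv\notin E(G)$, and let $Q$ be a subgraph of $G+uv$ isomorphic to $K_2\vee P_k$. Then $C(Q)\subseteq \{u,v\}\cup (N(u)\cap N(v))$, where $N(\cdot)$ denotes neighbourhood in $G$.
   Context: All graphs are finite and simple. $K_2\vee P_k$ is the join of an edge $K_2$ (the "center") with the path $P_k$ on $k$ vertices (the "path part"). For a copy $Q$ of $K_2\vee P_k$, $C(Q)$ denotes the set of the two vertices of $Q$ corresponding to the center $K_2$. A graph $G$ is $H$-saturated if it contains no copy of $H$ but adding any missing edge creates a copy of $H$. -}

module Defs where

open import Data.Nat using (ℕ; suc; _<_)
open import Data.Fin using (Fin; toℕ)
open import Data.Product using (_×_; Σ)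
open import Data.Sum using (_⊎_)
open import Relation.Nullary using (¬_)
open import Relation.Binary.PropositionalEquality using (_≡_; _≢_)
open import Function.Definitions using (Injective)

record Graph (n : ℕ) : Set₁ where
  field
    Adj   : Fin n → Fin n → Set
    sym   : ∀ {x y} → Adj x y → Adj y x
    irrefl : ∀ {x} → ¬ Adj x x
open Graph public

-- The graph K₂ ∨ P_k on vertex set Fin (2 + k):
-- vertices 0,1 form the center K₂, vertices 2,…,k+1 form the path P_k
-- (in this order), and every center vertex is joined to every other vertex.
JoinAdj : (k : ℕ) → Fin (2 Data.Nat.+ k) → Fin (2 Data.Nat.+ k) → Set
JoinAdj k i j = (i ≢ j) × (toℕ i < 2 ⊎ toℕ j < 2 ⊎ suc (toℕ i) ≡ toℕ j ⊎ suc (toℕ j) ≡ toℕ i)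

-- A copy of K₂ ∨ P_k in a graph with adjacency relation Adj on Fin n:
-- an injective map of the vertices that sends edges to edges
-- (i.e. a (not necessarily induced) subgraph isomorphic to K₂ ∨ P_k).
record Copy (k : ℕ) {n : ℕ} (Adj : Fin n → Fin n → Set) : Set where
  field
    f     : Fin (2 Data.Nat.+ k) → Fin n
    inj   : Injective _≡_ _≡_ f
    edges : ∀ i j → JoinAdj k i j → Adj (f i) (f j)
open Copy public

AddEdge : ∀ {n} → Graph n → Fin n → Fin n → Fin n → Fin n → Set
AddEdge G u v x y = Adj G x y ⊎ (x ≡ u × y ≡ v) ⊎ (x ≡ v × y ≡ u)

Saturated : (k : ℕ) → ∀ {n} → Graph n → Set
Saturated k G =
  ¬ Copy k (Adj G) ×
  (∀ u v → u ≢ v → ¬ Adj G u v → Copy k (AddEdge G u v))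

center₀ center₁ : ∀ {k n} {A : Fin n → Fin n → Set} → Copy k A → Fin n
center₀ Q = f Q Fin.zero where import Data.Fin as Fin
center₁ Q = f Q (Fin.suc Fin.zero) where import Data.Fin as Fin

InUVCommon : ∀ {n} → Graph n → Fin n → Fin n → Fin n → Set
InUVCommon G u v x = x ≡ u ⊎ x ≡ v ⊎ (Adj G x u × Adj G x v)

-- Since G contains no copy of K₂ ∨ P_k, the copy Q must use the new edge uv, so
-- both u and v are vertices of Q. A center vertex of Q is adjacent in G + uv to
-- every other vertex of Q, in particular to u and v; unless it is u or v itself,
-- these two edges are not the new edge, hence are edges of G.
module Submission where

open import Defs
open import Data.Nat using (ℕ; _≤_; _<_; s≤s; z≤n)
open import Data.Fin using (Fin; toℕ; _≟_)
open import Data.Fin.Properties using (any?)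
open import Data.Product using (_×_; _,_; ∃; proj₁)
open import Data.Sum using (inj₁; inj₂)
open import Data.Empty using (⊥-elim)
open import Relation.Nullary using (¬_; yes; no)
open import Relation.Binary.PropositionalEquality using (_≡_; _≢_; refl; cong)

module _ {n : ℕ} (G : Graph n) {u v : Fin n} where

  AddEdge-swap : ∀ {x y} → AddEdge G u v x y → AddEdge G v u x y
  AddEdge-swap (inj₁ xy) = inj₁ xy
  AddEdge-swap (inj₂ (inj₁ p)) = inj₂ (inj₂ p)
  AddEdge-swap (inj₂ (inj₂ p)) = inj₂ (inj₁ p)

  AddEdge-avoiding : ∀ {x y} → x ≢ u → y ≢ u → AddEdge G u v x y → Adj G x y
  AddEdge-avoiding _   _   (inj₁ xy) = xy
  AddEdge-avoiding x≢u _   (inj₂ (inj₁ (x≡u , _))) = ⊥-elim (x≢u x≡u)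
  AddEdge-avoiding _   y≢u (inj₂ (inj₂ (_ , y≡u))) = ⊥-elim (y≢u y≡u)

  AddEdge-from-other : ∀ {x y} → x ≢ u → x ≢ v → AddEdge G u v x y → Adj G x y
  AddEdge-from-other _   _   (inj₁ xy) = xy
  AddEdge-from-other x≢u _   (inj₂ (inj₁ (x≡u , _))) = ⊥-elim (x≢u x≡u)
  AddEdge-from-other _   x≢v (inj₂ (inj₂ (x≡v , _))) = ⊥-elim (x≢v x≡v)

Copy-map : ∀ {k n} {A B : Fin n → Fin n → Set} →
           (∀ {x y} → A x y → B x y) → Copy k A → Copy k B
Copy-map A⇒B Q = record { f = f Q ; inj = inj Q ; edges = λ i j ij → A⇒B (edges Q i j ij) }

Copy-center-adj : ∀ {k n} {A : Fin n → Fin n → Set} (Q : Copy k A) {a i} →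
                  toℕ a < 2 → a ≢ i → A (f Q a) (f Q i)
Copy-center-adj Q a<2 a≢i = edges Q _ _ (a≢i , inj₁ a<2)

module _ {k n : ℕ} (G : Graph n) (free : ¬ Copy k (Adj G)) where

  Copy-AddEdge-hits-u : ∀ {u v} (Q : Copy k (AddEdge G u v)) → ∃ λ i → f Q i ≡ u
  Copy-AddEdge-hits-u {u} Q with any? (λ i → f Q i ≟ u)
  ... | yes hit = hit
  ... | no miss = ⊥-elim (free record
    { f = f Q
    ; inj = inj Q
    ; edges = λ i j ij → AddEdge-avoiding G (λ p → miss (i , p)) (λ p → miss (j , p)) (edges Q i j ij)
    })

  Copy-AddEdge-hits-v : ∀ {u v} (Q : Copy k (AddEdge G u v)) → ∃ λ i → f Q i ≡ v
  Copy-AddEdge-hits-v Q = Copy-AddEdge-hits-u (Copy-map (AddEdge-swap G) Q)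

  Copy-AddEdge-center : ∀ {u v} (Q : Copy k (AddEdge G u v)) a → toℕ a < 2 →
                        InUVCommon G u v (f Q a)
  Copy-AddEdge-center {u} {v} Q a a<2 with f Q a ≟ u | f Q a ≟ v
  ... | yes fa≡u | _       = inj₁ fa≡u
  ... | no _    | yes fa≡v = inj₂ (inj₁ fa≡v)
  ... | no fa≢u | no fa≢v =
    inj₂ (inj₂ (adjacent fa≢u (Copy-AddEdge-hits-u Q) , adjacent fa≢v (Copy-AddEdge-hits-v Q)))
    where
    adjacent : ∀ {w} → f Q a ≢ w → ∃ (λ i → f Q i ≡ w) → Adj G (f Q a) w
    adjacent fa≢w (i , refl) =
      AddEdge-from-other G fa≢u fa≢v (Copy-center-adj Q a<2 (λ a≡i → fa≢w (cong (f Q) a≡i)))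

-- Only the (K₂ ∨ P_k)-freeness of G is needed.
corollary4p2 : (k : ℕ) → 3 ≤ k → (n : ℕ) → (G : Graph n) → Saturated k G →
    (u v : Fin n) → u ≢ v → ¬ Adj G u v →
    (Q : Copy k (AddEdge G u v)) →
    InUVCommon G u v (center₀ Q) × InUVCommon G u v (center₁ Q)
corollary4p2 k _ n G saturated u v _ _ Q =
  Copy-AddEdge-center G free Q _ (s≤s z≤n) , Copy-AddEdge-center G free Q _ (s≤s (s≤s z≤n))
  where
  free : ¬ Copy k (Adj G)
  free = proj₁ saturated
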